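{- For all positive integers $\ell$, $n$, $k$, $$f_\ell(n,k) \leq 2^{\lfloor \ell/2 \rfloor}\cdot \lfloor \ell/2\rfloor ! \cdot n^{\lfloor (\ell+1)/2 \rfloor}.$$ Moreover, if $k \geq \lfloor \log_2(\ell+1)\rfloor$, then $$f_\ell(n,k) \geq \left\lfloor \frac{n}{k}\right\rfloor^{\lfloor \log_2(\ell+1)\rfloor}.$$
   Context: For integers $n,k\ge1$, the Kneser graph $KG(n,k)$ has as vertices the $k$-element subsets of an $n$-element set, two vertices adjacent iff the sets are disjoint. The xor-product $G_1 \cdots G_\ell$ of graphs has vertex set $V(G_1)\times\cdots\times V(G_\ell)$, and two distinct vertices $(g_1,\dots,g_\ell)$, $(g_1',\dots,g_\ell')$ are adjacent iff $g_ig_i'\in E(G_i)$ for an odd number of indices $i$. $f_\ell(n,k)$ denotes the clique number of the xor-product of $\ell$ copies of $KG(n,k)$. Equivalently, $f_\ell(n,k)$ is the maximum size of a family $\mathcal{S}$ of subsets of $A_1\cup\dots\cup A_\ell$ (pairwise disjoint sets with $|A_i|=n$) such that $|S\cap A_i|=k$ for all $S\in\mathcal S$ and all $i$, and for distinct $S,T\in\mathcal S$ the set $S\cap T\cap A_i$ is empty for an odd number of indices $i$. -}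

module Defs where

open import Data.Nat using (ℕ; _%_; _/_; _^_; _*_; _+_; _≤_; _!)
open import Data.Nat.Logarithm using (⌊log₂_⌋)
open import Data.Bool using (Bool; not)
import Data.Bool.Properties as BoolP
open import Data.Fin.Subset using (Subset; _∩_; ⊥; ∣_∣)
open import Data.Vec using (Vec; zipWith; countᵇ)
open import Data.Vec.Properties using (≡-dec)
open import Data.Vec.Relation.Unary.All using (All)
open import Data.List using (List; length)
open import Data.List.Relation.Unary.All as L using ()
open import Data.List.Relation.Unary.AllPairs using (AllPairs)
open import Relation.Binary.PropositionalEquality using (_≡_; _≢_)
open import Relation.Nullary.Decidable using (⌊_⌋)

IsKneserVertex : (n k : ℕ) → Subset n → Set
IsKneserVertex n k A = ∣ A ∣ ≡ k

disjointᵇ : {n : ℕ} → Subset n → Subset n → Bool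
disjointᵇ A B = ⌊ ≡-dec BoolP._≟_ (A ∩ B) ⊥ ⌋

IsXorVertex : (ℓ n k : ℕ) → Vec (Subset n) ℓ → Set
IsXorVertex ℓ n k g = All (IsKneserVertex n k) g

numAdjCoords : {ℓ n : ℕ} → Vec (Subset n) ℓ → Vec (Subset n) ℓ → ℕ
numAdjCoords g g' = countᵇ (λ b → b) (zipWith disjointᵇ g g')

XorAdj : {ℓ n : ℕ} → Vec (Subset n) ℓ → Vec (Subset n) ℓ → Set
XorAdj g g' = (g ≢ g') Data.Product.× (numAdjCoords g g' % 2 ≡ 1)
  where import Data.Product

-- A clique in the xor-product of ℓ copies of KG(n,k), given as a list of
-- vertices which are pairwise adjacent (hence pairwise distinct);
-- its size is the length of the list.
IsXorKneserClique : (ℓ n k : ℕ) → List (Vec (Subset n) ℓ) → Set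
IsXorKneserClique ℓ n k C = L.All (IsXorVertex ℓ n k) C Data.Product.× AllPairs XorAdj C
  where import Data.Product

-- f_ℓ(n,k) ≤ B : every clique has size at most B.
fUpperBound : (ℓ n k B : ℕ) → Set
fUpperBound ℓ n k B = (C : List (Vec (Subset n) ℓ)) → IsXorKneserClique ℓ n k C → length C ≤ B

-- f_ℓ(n,k) ≥ B : some clique has size at least B.
fLowerBound : (ℓ n k B : ℕ) → Set
fLowerBound ℓ n k B = Data.Product.Σ (List (Vec (Subset n) ℓ))
  (λ C → IsXorKneserClique ℓ n k C Data.Product.× B ≤ length C)
  where import Data.Product

{-# OPTIONS --safe #-}
module Submission where

-- Deleting coordinate i from the members of a clique whose i-th set contains a
-- point x leaves a clique of the product with one factor fewer: two such members are not
-- adjacent in coordinate i, so the parity of their adjacency count is unchanged.  Summing over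
-- x counts every member k times, whence k·f_{ℓ+1} ≤ n·f_ℓ.  If ℓ+1 is even, a fixed member S of
-- a clique F shares a point with every member of F in some coordinate (they are disjoint in an
-- odd number of coordinates, hence not in all ℓ+1), so |F| ≤ Σ_i Σ_{x ∈ S_i} |F_{i,x}|, and each
-- inner sum is at most k · (n·f_{ℓ-1}/k).  Hence f_{2m+1} ≤ n·f_{2m} and f_{2m+2} ≤ (2m+2)·n·f_{2m}.
--
-- Cut [n] into k blocks of m = ⌊n/k⌋ points; a word u ∈ [m]^k encodes the k-set
-- taking the u_j-th point of block j, and two encodings are disjoint iff the words differ
-- everywhere.  Let t = ⌊log₂(ℓ+1)⌋ ≤ k.  The vertex of a word a ∈ [m]^t has, for each of the
-- 2^t - 1 nonempty V ⊆ [t], a coordinate encoding a restricted to V (padded to length k by a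
-- letter of a on V); its remaining coordinates all hold one fixed set.  The vertices of a ≠ b
-- are adjacent exactly in the coordinates V contained in the nonempty set D where a and b
-- differ, and there are 2^|D| - 1 of those, an odd number.

open import Defs

open import Data.Bool using (Bool; true; false; not; _∧_; T; if_then_else_)
open import Data.Bool.Properties using (∧-zeroʳ; ∧-identityʳ; ∧-assoc; T-∧; T-≡)
open import Data.Fin using (Fin; zero; suc; combine; finToFun; funToFin)
open import Data.Fin.Properties using (_≟_; funToFin-finToFin)
open import Data.Fin.Subset using (Subset; ∣_∣; ⊥; ⊤; ⁅_⁆)
open import Data.Fin.Subset.Properties using (∣⊥∣≡0; ∣⁅x⁆∣≡1)
import Data.List as List
open List using (List; []; _∷_; length; filterᵇ)
open import Data.List.Properties using (length-++; length-map; length-tabulate; map-++; map-∘; map-cong)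
import Data.List.Relation.Unary.All as All
open All using ([]; _∷_)
import Data.List.Relation.Unary.All.Properties as All
import Data.List.Relation.Unary.AllPairs as AllPairs
open AllPairs using ([]; _∷_)
import Data.List.Relation.Unary.AllPairs.Properties as AllPairs
open import Data.Nat
  using (ℕ; zero; suc; _+_; _*_; _∸_; _^_; _/_; _%_; _!; _≤_; _<_; z≤n; s≤s; s≤s⁻¹; s<s⁻¹; NonZero; >-nonZero⁻¹;
         ⌊_/2⌋; ⌈_/2⌉)
open import Data.Nat.DivMod using (m*n%n≡0; [m+kn]%n≡m%n; m/n≡1+[m∸n]/n; m/n*n≤m)
open import Data.Nat.Induction using (<-wellFounded)
open import Data.Nat.ListAction using (sum)
open import Data.Nat.ListAction.Properties using (sum-++)
open import Data.Nat.Logarithm using (⌊log₂_⌋; ⌊log₂⌋-mono-≤)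
open import Data.Nat.Logarithm.Core using (⌊log2⌋)
open import Data.Nat.Properties
  using (+-assoc; +-comm; +-identityʳ; *-comm; *-suc; *-zeroʳ; ≤-refl; ≤-reflexive; ≤-trans; m≤m+n; m≤n+m; +-mono-≤;
         +-monoʳ-≤; *-monoʳ-≤; *-cancelˡ-≤; m≤n*m; ≤∧≢⇒<; m+[n∸m]≡n; ⌊n/2⌋≤⌈n/2⌉; ⌊n/2⌋+⌈n/2⌉≡n;
         +-commutativeSemigroup; *-commutativeSemigroup; +-*-semiring; module ≤-Reasoning)
open import Data.Nat.Tactic.RingSolver using (solve-∀)
open import Algebra.Properties.CommutativeSemigroup +-commutativeSemigroup
  using () renaming (x∙yz≈y∙xz to x+[y+z]≡y+[x+z])
open import Algebra.Properties.CommutativeSemigroup *-commutativeSemigroup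
  using () renaming (x∙yz≈y∙xz to x*[y*z]≡y*[x*z])
open import Algebra.Properties.Semiring.Sum +-*-semiring
  using (sum-syntax; sum-cong-≗; ∑-distrib-+; *-distribˡ-sum; *-distribʳ-sum)
open import Data.Product using (Σ; ∃; ∃₂; _×_; _,_; proj₁)
import Data.Product as Product
open import Data.Sum using (_⊎_; inj₁; inj₂; [_,_]′)
import Data.Sum as Sum
open import Data.Vec
  using (Vec; []; _∷_; lookup; removeAt; countᵇ; zipWith; replicate; _++_; concat; map; fromList; tabulate)
open import Data.Vec.Properties
  using (count≤n; zipWith-++; zipWith-replicate; lookup-zipWith; lookup-replicate; lookup∘tabulate)
import Data.Vec.Relation.Unary.All as VAll
open VAll using ([]; _∷_)
import Data.Vec.Relation.Unary.All.Properties as VAll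
open import Function using (id; _∘_; Equivalence)
open import Induction.WellFounded using (Acc; acc)
open import Level using (0ℓ)
open import Relation.Binary using (Rel)
open import Relation.Binary.PropositionalEquality
  using (_≡_; _≢_; refl; sym; trans; cong; cong₂; subst; subst₂; module ≡-Reasoning)
open import Relation.Nullary using (Dec; yes; no; contradiction)
open import Relation.Nullary.Decidable using (does; isYes≗does; T?)
open import Relation.Unary using (Pred)

⟦_⟧ : Bool → ℕ
⟦ true ⟧  = 1
⟦ false ⟧ = 0

∑-mono-≤ : ∀ {N} {f g : Fin N → ℕ} → (∀ i → f i ≤ g i) → ∑[ i < N ] f i ≤ ∑[ i < N ] g i
∑-mono-≤ {zero}  f≤g = z≤n
∑-mono-≤ {suc N} f≤g = +-mono-≤ (f≤g zero) (∑-mono-≤ (f≤g ∘ suc))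

∑-const : ∀ N c → ∑[ i < N ] c ≡ N * c
∑-const zero    c = refl
∑-const (suc N) c = cong (c +_) (∑-const N c)

term≤∑ : ∀ {N} (f : Fin N → ℕ) i → f i ≤ ∑[ j < N ] f j
term≤∑ f zero    = m≤m+n _ _
term≤∑ f (suc i) = ≤-trans (term≤∑ (f ∘ suc) i) (m≤n+m _ (f zero))

length-filterᵇ-∷ : ∀ {X : Set} (p : X → Bool) x xs →
  length (filterᵇ p (x ∷ xs)) ≡ ⟦ p x ⟧ + length (filterᵇ p xs)
length-filterᵇ-∷ p x xs with p x
... | true  = refl
... | false = refl

∑-length-filterᵇ-∷ : ∀ {X : Set} {N} (p : Fin N → X → Bool) x xs →
  ∑[ i < N ] length (filterᵇ (p i) (x ∷ xs)) ≡ ∑[ i < N ] ⟦ p i x ⟧ + ∑[ i < N ] length (filterᵇ (p i) xs)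
∑-length-filterᵇ-∷ p x xs =
  trans (sum-cong-≗ (λ i → length-filterᵇ-∷ (p i) x xs)) (∑-distrib-+ (λ i → ⟦ p i x ⟧) _)

length-filterᵇ-∧ : ∀ {X : Set} β (q : X → Bool) xs →
  length (filterᵇ (λ x → β ∧ q x) xs) ≡ ⟦ β ⟧ * length (filterᵇ q xs)
length-filterᵇ-∧ true  q xs       = sym (+-identityʳ _)
length-filterᵇ-∧ false q []       = refl
length-filterᵇ-∧ false q (x ∷ xs) = length-filterᵇ-∧ false q xs

containing : ∀ {X : Set} {n} → (X → Subset n) → Fin n → List X → List X
containing A x = filterᵇ (λ c → lookup (A c) x)

All-removeAt : ∀ {X : Set} {P : Pred X 0ℓ} {ℓ} {g : Vec X (suc ℓ)} i →
  VAll.All P g → VAll.All P (removeAt g i)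
All-removeAt zero (_ ∷ pg) = pg
All-removeAt {g = _ ∷ _ ∷ _} (suc i) (pa ∷ pg) = pa ∷ All-removeAt i pg

AllPairs-with-All : ∀ {X : Set} {P : Pred X 0ℓ} {R : Rel X 0ℓ} {xs} → All.All P xs → AllPairs.AllPairs R xs →
  AllPairs.AllPairs (λ a b → P a × P b × R a b) xs
AllPairs-with-All []        []        = []
AllPairs-with-All (pa ∷ ps) (ra ∷ rs) = All.map (pa ,_) (All.zip (ps , ra)) ∷ AllPairs-with-All ps rs

disjointᵇ-∷ : ∀ {n} a b (A B : Subset n) → disjointᵇ (a ∷ A) (b ∷ B) ≡ not (a ∧ b) ∧ disjointᵇ A B
disjointᵇ-∷ a b A B = trans (isYes≗does _) (cong₂ _∧_ (≟false (a ∧ b)) (sym (isYes≗does _)))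
  where
  ≟false : ∀ c → does (c Data.Bool.≟ false) ≡ not c
  ≟false false = refl
  ≟false true  = refl

disjointᵇ-⊥ˡ : ∀ {n} (B : Subset n) → disjointᵇ ⊥ B ≡ true
disjointᵇ-⊥ˡ []      = refl
disjointᵇ-⊥ˡ (b ∷ B) = trans (disjointᵇ-∷ false b ⊥ B) (disjointᵇ-⊥ˡ B)

disjointᵇ-⊥ʳ : ∀ {n} (A : Subset n) → disjointᵇ A ⊥ ≡ true
disjointᵇ-⊥ʳ []      = refl
disjointᵇ-⊥ʳ (a ∷ A) =
  trans (disjointᵇ-∷ a false A ⊥) (trans (cong (λ b → not b ∧ disjointᵇ A ⊥) (∧-zeroʳ a)) (disjointᵇ-⊥ʳ A))

common⇒¬disjointᵇ : ∀ {n} {A B : Subset n} x → T (lookup A x) → T (lookup B x) → disjointᵇ A B ≡ false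
common⇒¬disjointᵇ {A = true ∷ A} {true ∷ B} zero _ _ = disjointᵇ-∷ true true A B
common⇒¬disjointᵇ {A = a ∷ A} {b ∷ B} (suc x) Ax Bx = begin
  disjointᵇ (a ∷ A) (b ∷ B)   ≡⟨ disjointᵇ-∷ a b A B ⟩
  not (a ∧ b) ∧ disjointᵇ A B ≡⟨ cong (not (a ∧ b) ∧_) (common⇒¬disjointᵇ x Ax Bx) ⟩
  not (a ∧ b) ∧ false         ≡⟨ ∧-zeroʳ _ ⟩
  false                       ∎
  where open ≡-Reasoning

¬disjointᵇ⇒common : ∀ {n} (A B : Subset n) → disjointᵇ A B ≡ false →
  ∃ λ x → T (lookup A x) × T (lookup B x)
¬disjointᵇ⇒common []          []          ()
¬disjointᵇ⇒common (true ∷ A)  (true ∷ B)  _  = zero , _ , _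
¬disjointᵇ⇒common (true ∷ A)  (false ∷ B) AB =
  Product.map suc id (¬disjointᵇ⇒common A B (trans (sym (disjointᵇ-∷ true false A B)) AB))
¬disjointᵇ⇒common (false ∷ A) (b ∷ B)     AB =
  Product.map suc id (¬disjointᵇ⇒common A B (trans (sym (disjointᵇ-∷ false b A B)) AB))

inhabitant : ∀ {n} (A : Subset n) → 0 < ∣ A ∣ → ∃ λ x → T (lookup A x)
inhabitant (true ∷ A)  _  = zero , _
inhabitant (false ∷ A) 0<A = Product.map suc id (inhabitant A 0<A)

disjointᵇ-self : ∀ {n} (A : Subset n) → 0 < ∣ A ∣ → disjointᵇ A A ≡ false
disjointᵇ-self A 0<A = let x , Ax = inhabitant A 0<A in common⇒¬disjointᵇ x Ax Ax

∣A∣≡∑ : ∀ {n} (A : Subset n) → ∣ A ∣ ≡ ∑[ x < n ] ⟦ lookup A x ⟧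
∣A∣≡∑ []          = refl
∣A∣≡∑ (true ∷ A)  = cong suc (∣A∣≡∑ A)
∣A∣≡∑ (false ∷ A) = ∣A∣≡∑ A

∣p++q∣ : ∀ {a b} (p : Subset a) (q : Subset b) → ∣ p ++ q ∣ ≡ ∣ p ∣ + ∣ q ∣
∣p++q∣ []          q = refl
∣p++q∣ (true ∷ p)  q = cong suc (∣p++q∣ p q)
∣p++q∣ (false ∷ p) q = ∣p++q∣ p q

⊤-++ : ∀ a b → ⊤ {a + b} ≡ ⊤ {a} ++ ⊤ {b}
⊤-++ zero    b = refl
⊤-++ (suc a) b = cong (true ∷_) (⊤-++ a b)

disjointᵇ-++ : ∀ {a b} (p p′ : Subset a) (q q′ : Subset b) →
  disjointᵇ (p ++ q) (p′ ++ q′) ≡ disjointᵇ p p′ ∧ disjointᵇ q q′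
disjointᵇ-++ []      []       q q′ = refl
disjointᵇ-++ (x ∷ p) (y ∷ p′) q q′ = begin
  disjointᵇ (x ∷ p ++ q) (y ∷ p′ ++ q′)                ≡⟨ disjointᵇ-∷ x y (p ++ q) (p′ ++ q′) ⟩
  not (x ∧ y) ∧ disjointᵇ (p ++ q) (p′ ++ q′)           ≡⟨ cong (not (x ∧ y) ∧_) (disjointᵇ-++ p p′ q q′) ⟩
  not (x ∧ y) ∧ (disjointᵇ p p′ ∧ disjointᵇ q q′)       ≡⟨ ∧-assoc (not (x ∧ y)) _ _ ⟨
  (not (x ∧ y) ∧ disjointᵇ p p′) ∧ disjointᵇ q q′       ≡⟨ cong (_∧ disjointᵇ q q′) (disjointᵇ-∷ x y p p′) ⟨
  disjointᵇ (x ∷ p) (y ∷ p′) ∧ disjointᵇ q q′           ∎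
  where open ≡-Reasoning

disjointᵇ-⁅⁆ : ∀ {m} (x y : Fin m) → disjointᵇ ⁅ x ⁆ ⁅ y ⁆ ≡ not (does (x ≟ y))
disjointᵇ-⁅⁆ {suc m} zero zero = disjointᵇ-∷ true true (⊥ {m}) ⊥
disjointᵇ-⁅⁆ zero    (suc y) = trans (disjointᵇ-∷ true false ⊥ ⁅ y ⁆) (disjointᵇ-⊥ˡ ⁅ y ⁆)
disjointᵇ-⁅⁆ (suc x) zero    = trans (disjointᵇ-∷ false true ⁅ x ⁆ ⊥) (disjointᵇ-⊥ʳ ⁅ x ⁆)
disjointᵇ-⁅⁆ (suc x) (suc y) = trans (disjointᵇ-∷ false false ⁅ x ⁆ ⁅ y ⁆) (disjointᵇ-⁅⁆ x y)

∑-length-containing : ∀ {X : Set} {n s} (A : X → Subset n) (C : List X) → All.All (λ c → ∣ A c ∣ ≡ s) C →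
  ∑[ x < n ] length (containing A x C) ≡ length C * s
∑-length-containing {n = n} A []      []              = trans (∑-const n 0) (*-zeroʳ n)
∑-length-containing {n = n} {s} A (c ∷ C) (∣Ac∣≡s ∷ sizes) = begin
  ∑[ x < n ] length (containing A x (c ∷ C))
    ≡⟨ ∑-length-filterᵇ-∷ (λ x c → lookup (A c) x) c C ⟩
  ∑[ x < n ] ⟦ lookup (A c) x ⟧ + ∑[ x < n ] length (containing A x C)
    ≡⟨ cong₂ _+_ (trans (sym (∣A∣≡∑ (A c))) ∣Ac∣≡s) (∑-length-containing A C sizes) ⟩
  s + length C * s ∎
  where open ≡-Reasoning

length≤∑∑-filterᵇ : ∀ {X : Set} {a b} (p : Fin a → Fin b → X → Bool) (C : List X) →
  All.All (λ c → ∃₂ λ i x → T (p i x c)) C →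
  length C ≤ ∑[ i < a ] ∑[ x < b ] length (filterᵇ (p i x) C)
length≤∑∑-filterᵇ p []      []                    = z≤n
length≤∑∑-filterᵇ {a = a} {b} p (c ∷ C) ((i , x , pixc) ∷ covered) = begin
  1 + length C
    ≤⟨ +-mono-≤ (≤-trans (≤-trans (1≤⟦⟧ pixc) (term≤∑ _ x)) (term≤∑ _ i)) (length≤∑∑-filterᵇ p C covered) ⟩
  ∑[ i < a ] ∑[ x < b ] ⟦ p i x c ⟧ + ∑[ i < a ] ∑[ x < b ] length (filterᵇ (p i x) C)
    ≡⟨ trans (sum-cong-≗ (λ i → ∑-length-filterᵇ-∷ (p i) c C))
             (∑-distrib-+ (λ i → ∑[ x < b ] ⟦ p i x c ⟧) (λ i → ∑[ x < b ] length (filterᵇ (p i x) C))) ⟨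
  ∑[ i < a ] ∑[ x < b ] length (filterᵇ (p i x) (c ∷ C)) ∎
  where
  open ≤-Reasoning
  1≤⟦⟧ : ∀ {β} → T β → 1 ≤ ⟦ β ⟧
  1≤⟦⟧ {true} _ = ≤-refl

numAdjCoords-∷ : ∀ {ℓ n} (a b : Subset n) (g h : Vec (Subset n) ℓ) →
  numAdjCoords (a ∷ g) (b ∷ h) ≡ ⟦ disjointᵇ a b ⟧ + numAdjCoords g h
numAdjCoords-∷ a b g h = countᵇ-∷ (disjointᵇ a b)
  where
  countᵇ-∷ : ∀ c → countᵇ id (c ∷ zipWith disjointᵇ g h) ≡ ⟦ c ⟧ + numAdjCoords g h
  countᵇ-∷ true  = refl
  countᵇ-∷ false = refl

numAdjCoords-removeAt : ∀ {ℓ n} (g h : Vec (Subset n) (suc ℓ)) i →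
  numAdjCoords g h ≡ ⟦ disjointᵇ (lookup g i) (lookup h i) ⟧ + numAdjCoords (removeAt g i) (removeAt h i)
numAdjCoords-removeAt (a ∷ g) (b ∷ h) zero = numAdjCoords-∷ a b g h
numAdjCoords-removeAt (a ∷ g@(_ ∷ _)) (b ∷ h@(_ ∷ _)) (suc i) = begin
  numAdjCoords (a ∷ g) (b ∷ h)                ≡⟨ numAdjCoords-∷ a b g h ⟩
  ⟦ disjointᵇ a b ⟧ + numAdjCoords g h         ≡⟨ cong (⟦ disjointᵇ a b ⟧ +_) (numAdjCoords-removeAt g h i) ⟩
  ⟦ disjointᵇ a b ⟧ + (⟦ gᵢ∩hᵢ ⟧ + numAdjCoords g′ h′) ≡⟨ x+[y+z]≡y+[x+z] ⟦ disjointᵇ a b ⟧ ⟦ gᵢ∩hᵢ ⟧ _ ⟩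
  ⟦ gᵢ∩hᵢ ⟧ + (⟦ disjointᵇ a b ⟧ + numAdjCoords g′ h′) ≡⟨ cong (⟦ gᵢ∩hᵢ ⟧ +_) (numAdjCoords-∷ a b g′ h′) ⟨
  ⟦ gᵢ∩hᵢ ⟧ + numAdjCoords (a ∷ g′) (b ∷ h′)   ∎
  where
  open ≡-Reasoning
  gᵢ∩hᵢ : Bool
  gᵢ∩hᵢ = disjointᵇ (lookup g i) (lookup h i)
  g′ h′ : Vec (Subset _) _
  g′ = removeAt g i
  h′ = removeAt h i

numAdjCoords-++ : ∀ {a b n} (g g′ : Vec (Subset n) a) (h h′ : Vec (Subset n) b) →
  numAdjCoords (g ++ h) (g′ ++ h′) ≡ numAdjCoords g g′ + numAdjCoords h h′
numAdjCoords-++ []      []       h h′ = refl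
numAdjCoords-++ (x ∷ g) (y ∷ g′) h h′ = begin
  numAdjCoords (x ∷ g ++ h) (y ∷ g′ ++ h′)                      ≡⟨ numAdjCoords-∷ x y (g ++ h) (g′ ++ h′) ⟩
  ⟦ disjointᵇ x y ⟧ + numAdjCoords (g ++ h) (g′ ++ h′)           ≡⟨ cong (⟦ disjointᵇ x y ⟧ +_) (numAdjCoords-++ g g′ h h′) ⟩
  ⟦ disjointᵇ x y ⟧ + (numAdjCoords g g′ + numAdjCoords h h′)    ≡⟨ +-assoc ⟦ disjointᵇ x y ⟧ _ _ ⟨
  (⟦ disjointᵇ x y ⟧ + numAdjCoords g g′) + numAdjCoords h h′    ≡⟨ cong (_+ numAdjCoords h h′) (numAdjCoords-∷ x y g g′) ⟨
  numAdjCoords (x ∷ g) (y ∷ g′) + numAdjCoords h h′              ∎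
  where open ≡-Reasoning

numAdjCoords-map : ∀ {X : Set} {n} (f f′ : X → Subset n) (xs : List X) →
  numAdjCoords (map f (fromList xs)) (map f′ (fromList xs)) ≡ sum (List.map (λ x → ⟦ disjointᵇ (f x) (f′ x) ⟧) xs)
numAdjCoords-map f f′ []       = refl
numAdjCoords-map f f′ (x ∷ xs) =
  trans (numAdjCoords-∷ (f x) (f′ x) (map f (fromList xs)) (map f′ (fromList xs)))
        (cong (⟦ disjointᵇ (f x) (f′ x) ⟧ +_) (numAdjCoords-map f f′ xs))

numAdjCoords≤ : ∀ {ℓ n} (g h : Vec (Subset n) ℓ) → numAdjCoords g h ≤ ℓ
numAdjCoords≤ g h = count≤n _ (zipWith disjointᵇ g h)

numAdjCoords<⇒∃¬disjointᵇ : ∀ {ℓ n} (g h : Vec (Subset n) ℓ) → numAdjCoords g h < ℓ →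
  ∃ λ i → disjointᵇ (lookup g i) (lookup h i) ≡ false
numAdjCoords<⇒∃¬disjointᵇ (a ∷ g) (b ∷ h) lt
  with disjointᵇ a b in ab | subst (_< _) (numAdjCoords-∷ a b g h) lt
... | false | _   = zero , ab
... | true  | lt′ = Product.map suc id (numAdjCoords<⇒∃¬disjointᵇ g h (s<s⁻¹ lt′))

module _ {n k : ℕ} .{{_ : NonZero k}} where

  numAdjCoords-self : ∀ {ℓ} (g : Vec (Subset n) ℓ) → IsXorVertex ℓ n k g → numAdjCoords g g ≡ 0
  numAdjCoords-self []      []           = refl
  numAdjCoords-self (a ∷ g) (∣a∣≡k ∷ vg) = begin
    numAdjCoords (a ∷ g) (a ∷ g)          ≡⟨ numAdjCoords-∷ a a g g ⟩
    ⟦ disjointᵇ a a ⟧ + numAdjCoords g g  ≡⟨ cong₂ (λ b m → ⟦ b ⟧ + m) (disjointᵇ-self a 0<∣a∣) (numAdjCoords-self g vg) ⟩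
    0                                     ∎
    where
    open ≡-Reasoning
    0<∣a∣ = subst (0 <_) (sym ∣a∣≡k) (>-nonZero⁻¹ k)

  odd⇒distinct : ∀ {ℓ} {g h : Vec (Subset n) ℓ} → IsXorVertex ℓ n k g → numAdjCoords g h % 2 ≡ 1 → g ≢ h
  odd⇒distinct {g = g} vg odd refl with trans (cong (_% 2) (sym (numAdjCoords-self g vg))) odd
  ... | ()

-- Upper bound

2*m%2≡0 : ∀ m → (2 * m) % 2 ≡ 0
2*m%2≡0 m = trans (cong (_% 2) (*-comm 2 m)) (m*n%n≡0 m 2)

[2+n]/2≡1+n/2 : ∀ n → (2 + n) / 2 ≡ 1 + n / 2
[2+n]/2≡1+n/2 n = m/n≡1+[m∸n]/n {2 + n} (s≤s (s≤s z≤n))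

parity-split : ∀ ℓ → (ℓ ≡ 2 * (ℓ / 2) × (ℓ + 1) / 2 ≡ ℓ / 2)
                   ⊎ (ℓ ≡ 1 + 2 * (ℓ / 2) × (ℓ + 1) / 2 ≡ 1 + ℓ / 2)
parity-split 0 = inj₁ (refl , refl)
parity-split 1 = inj₂ (refl , refl)
parity-split (suc (suc ℓ)) rewrite [2+n]/2≡1+n/2 ℓ | [2+n]/2≡1+n/2 (ℓ + 1) | *-suc 2 (ℓ / 2) =
  Sum.map (Product.map (cong (2 +_)) (cong suc)) (Product.map (cong (2 +_)) (cong suc)) (parity-split ℓ)

private
  even-step-identity : ∀ m n a b c → (2 + 2 * m) * (n * (a * b * c)) ≡ 2 * a * (suc m * b) * (n * c)
  even-step-identity = solve-∀

  odd-step-identity : ∀ n a b c → n * (a * b * c) ≡ a * b * (n * c)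
  odd-step-identity = solve-∀

module UpperBound (n k : ℕ) .{{_ : NonZero k}} where

  restrict : ∀ {ℓ} → Fin (suc ℓ) → Fin n → List (Vec (Subset n) (suc ℓ)) → List (Vec (Subset n) ℓ)
  restrict i x C = List.map (λ g → removeAt g i) (containing (λ g → lookup g i) x C)

  length-restrict : ∀ {ℓ} i x (C : List (Vec (Subset n) (suc ℓ))) →
    length (restrict i x C) ≡ length (containing (λ g → lookup g i) x C)
  length-restrict i x C = length-map (λ g → removeAt g i) (containing (λ g → lookup g i) x C)

  restrict-adjacent : ∀ {ℓ} {g h : Vec (Subset n) (suc ℓ)} i x → IsXorVertex (suc ℓ) n k g →
    T (lookup (lookup g i) x) → T (lookup (lookup h i) x) → XorAdj g h → XorAdj (removeAt g i) (removeAt h i)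
  restrict-adjacent {g = g} {h} i x vg gx hx (_ , odd) = odd⇒distinct (All-removeAt i vg) odd′ , odd′
    where
    odd′ : numAdjCoords (removeAt g i) (removeAt h i) % 2 ≡ 1
    odd′ = begin
      numAdjCoords (removeAt g i) (removeAt h i) % 2
        ≡⟨ cong (λ b → (⟦ b ⟧ + numAdjCoords (removeAt g i) (removeAt h i)) % 2)
                (common⇒¬disjointᵇ {A = lookup g i} x gx hx) ⟨
      (⟦ disjointᵇ (lookup g i) (lookup h i) ⟧ + numAdjCoords (removeAt g i) (removeAt h i)) % 2
        ≡⟨ cong (_% 2) (numAdjCoords-removeAt g h i) ⟨
      numAdjCoords g h % 2
        ≡⟨ odd ⟩
      1 ∎
      where open ≡-Reasoning

  restrict-clique : ∀ {ℓ} {C : List (Vec (Subset n) (suc ℓ))} i x →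
    IsXorKneserClique (suc ℓ) n k C → IsXorKneserClique ℓ n k (restrict i x C)
  restrict-clique {ℓ} {C} i x (vertices , adjacent) =
    All.map⁺ (All.map (All-removeAt i) (All.filter⁺ contains? vertices)) ,
    AllPairs.map⁺ (AllPairs.map (λ ((vg , gx) , (_ , hx) , adj) → restrict-adjacent i x vg gx hx adj)
                                (AllPairs-with-All (All.zip (All.filter⁺ contains? vertices ,
                                                             All.all-filter contains? C))
                                                   (AllPairs.filter⁺ contains? adjacent)))
    where
    contains? : (g : Vec (Subset n) (suc ℓ)) → Dec (T (lookup (lookup g i) x))
    contains? g = T? (lookup (lookup g i) x)

  ScaledBound : ℕ → ℕ → Set
  ScaledBound ℓ B = ∀ C → IsXorKneserClique ℓ n k C → k * length C ≤ B

  ScaledBound⇒fUpperBound : ∀ {ℓ B} → ScaledBound ℓ B → fUpperBound ℓ n k B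
  ScaledBound⇒fUpperBound sb C cl = ≤-trans (m≤n*m (length C) k) (sb C cl)

  fUpperBound⇒ScaledBound : ∀ {ℓ B} → fUpperBound ℓ n k B → ScaledBound (suc ℓ) (n * B)
  fUpperBound⇒ScaledBound {B = B} ub C cl@(vertices , _) = begin
    k * length C                                              ≡⟨ *-comm k (length C) ⟩
    length C * k                                              ≡⟨ ∑-length-containing (λ g → lookup g zero) C
                                                                   (All.map (λ vg → VAll.lookup⁺ vg zero) vertices) ⟨
    ∑[ x < n ] length (containing (λ g → lookup g zero) x C)  ≡⟨ sum-cong-≗ (λ x → length-restrict zero x C) ⟨
    ∑[ x < n ] length (restrict zero x C)                     ≤⟨ ∑-mono-≤ (λ x → ub _ (restrict-clique zero x cl)) ⟩
    ∑[ x < n ] B                                              ≡⟨ ∑-const n B ⟩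
    n * B                                                     ∎
    where open ≤-Reasoning

  shares : ∀ {ℓ} → Vec (Subset n) ℓ → Fin ℓ → Fin n → Vec (Subset n) ℓ → Bool
  shares S i x g = lookup (lookup S i) x ∧ lookup (lookup g i) x

  shares-self : ∀ {ℓ} {S : Vec (Subset n) (suc ℓ)} → IsXorVertex (suc ℓ) n k S → ∃₂ λ i x → T (shares S i x S)
  shares-self {S = S} vS =
    let x , Sx = inhabitant (lookup S zero) (subst (0 <_) (sym (VAll.lookup⁺ vS zero)) (>-nonZero⁻¹ k))
    in zero , x , Equivalence.from T-∧ (Sx , Sx)

  shares-neighbour : ∀ {m} {S g : Vec (Subset n) (2 + 2 * m)} → XorAdj S g → ∃₂ λ i x → T (shares S i x g)
  shares-neighbour {m} {S} {g} (_ , odd) =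
    let i , Sᵢ∦gᵢ = numAdjCoords<⇒∃¬disjointᵇ S g (≤∧≢⇒< (numAdjCoords≤ S g) not-all)
        x , Sx , gx = ¬disjointᵇ⇒common (lookup S i) (lookup g i) Sᵢ∦gᵢ
    in i , x , Equivalence.from T-∧ (Sx , gx)
    where
    not-all : numAdjCoords S g ≢ 2 + 2 * m
    not-all all-coords with trans (sym (2*m%2≡0 m)) (trans (cong (_% 2) (sym all-coords)) odd)
    ... | ()

  ∑-shares≤ : ∀ {ℓ B} → ScaledBound ℓ B → ∀ {S F} →
    IsXorVertex (suc ℓ) n k S → IsXorKneserClique (suc ℓ) n k F →
    ∀ i → ∑[ x < n ] length (filterᵇ (shares S i x) F) ≤ B
  ∑-shares≤ {B = B} sb {S} {F} vS cl i = *-cancelˡ-≤ k (begin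
    k * ∑[ x < n ] length (filterᵇ (shares S i x) F)
      ≡⟨ cong (k *_) (sum-cong-≗ (λ x → length-filterᵇ-∧ (s x) _ F)) ⟩
    k * ∑[ x < n ] (⟦ s x ⟧ * L x)                    ≡⟨ *-distribˡ-sum k (λ x → ⟦ s x ⟧ * L x) ⟩
    ∑[ x < n ] (k * (⟦ s x ⟧ * L x))                  ≤⟨ ∑-mono-≤ weighted ⟩
    ∑[ x < n ] (⟦ s x ⟧ * B)                          ≡⟨ *-distribʳ-sum B (λ x → ⟦ s x ⟧) ⟨
    (∑[ x < n ] ⟦ s x ⟧) * B
      ≡⟨ cong (_* B) (trans (sym (∣A∣≡∑ (lookup S i))) (VAll.lookup⁺ vS i)) ⟩
    k * B                                             ∎)
    where
    open ≤-Reasoning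
    s : Fin n → Bool
    s = lookup (lookup S i)
    L : Fin n → ℕ
    L x = length (containing (λ g → lookup g i) x F)
    weighted : ∀ x → k * (⟦ s x ⟧ * L x) ≤ ⟦ s x ⟧ * B
    weighted x = begin
      k * (⟦ s x ⟧ * L x)                      ≡⟨ x*[y*z]≡y*[x*z] k ⟦ s x ⟧ (L x) ⟩
      ⟦ s x ⟧ * (k * L x)                      ≡⟨ cong (λ l → ⟦ s x ⟧ * (k * l)) (length-restrict i x F) ⟨
      ⟦ s x ⟧ * (k * length (restrict i x F))  ≤⟨ *-monoʳ-≤ ⟦ s x ⟧ (sb _ (restrict-clique i x cl)) ⟩
      ⟦ s x ⟧ * B                              ∎

  fUpperBound-even-step : ∀ {m B} → ScaledBound (1 + 2 * m) B → fUpperBound (2 + 2 * m) n k ((2 + 2 * m) * B)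
  fUpperBound-even-step sb [] _ = z≤n
  fUpperBound-even-step {m} {B} sb F@(S ∷ _) cl@(vS ∷ _ , adjS ∷ _) = begin
    length F                                                          ≤⟨ length≤∑∑-filterᵇ (shares S) F covered ⟩
    ∑[ i < 2 + 2 * m ] ∑[ x < n ] length (filterᵇ (shares S i x) F)   ≤⟨ ∑-mono-≤ (∑-shares≤ sb vS cl) ⟩
    ∑[ i < 2 + 2 * m ] B                                              ≡⟨ ∑-const (2 + 2 * m) B ⟩
    (2 + 2 * m) * B                                                   ∎
    where
    open ≤-Reasoning
    covered : All.All (λ g → ∃₂ λ i x → T (shares S i x g)) F
    covered = shares-self vS ∷ All.map (shares-neighbour {m}) adjS

  fUpperBound-0 : fUpperBound 0 n k 1
  fUpperBound-0 []          _                                 = z≤n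
  fUpperBound-0 (_ ∷ [])    _                                 = ≤-refl
  fUpperBound-0 ([] ∷ [] ∷ _) (_ , ((distinct , _) ∷ _) ∷ _) = contradiction refl distinct

  fUpperBound-even : ∀ m → fUpperBound (2 * m) n k (2 ^ m * m ! * n ^ m)
  fUpperBound-even zero    = fUpperBound-0
  fUpperBound-even (suc m) =
    subst₂ (λ ℓ B → fUpperBound ℓ n k B) (sym (*-suc 2 m)) (even-step-identity m n (2 ^ m) (m !) (n ^ m))
      (fUpperBound-even-step {m} (fUpperBound⇒ScaledBound (fUpperBound-even m)))

  fUpperBound-odd : ∀ m → fUpperBound (1 + 2 * m) n k (2 ^ m * m ! * n ^ (1 + m))
  fUpperBound-odd m = subst (fUpperBound (1 + 2 * m) n k) (odd-step-identity n (2 ^ m) (m !) (n ^ m))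
    (ScaledBound⇒fUpperBound (fUpperBound⇒ScaledBound (fUpperBound-even m)))

  fUpperBound-formula : ∀ ℓ → fUpperBound ℓ n k (2 ^ (ℓ / 2) * (ℓ / 2) ! * n ^ ((ℓ + 1) / 2))
  fUpperBound-formula ℓ = [ (λ (ℓ≡2h , e≡h) → subst₂ Bound (sym ℓ≡2h) (sym e≡h) (fUpperBound-even h))
                          , (λ (ℓ≡1+2h , e≡1+h) → subst₂ Bound (sym ℓ≡1+2h) (sym e≡1+h) (fUpperBound-odd h))
                          ]′ (parity-split ℓ)
    where
    h : ℕ
    h = ℓ / 2
    Bound : ℕ → ℕ → Set
    Bound ℓ′ e = fUpperBound ℓ′ n k (2 ^ h * h ! * n ^ e)

-- Lower bound

agreement : ∀ {m s} → Vec (Fin m) s → Vec (Fin m) s → Subset s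
agreement = zipWith (λ x y → does (x ≟ y))

agreement-≢ : ∀ {m s} {u w : Vec (Fin m) s} → u ≢ w → ∃ λ j → lookup (agreement u w) j ≡ false
agreement-≢ {u = []}    {[]}    u≢w = contradiction refl u≢w
agreement-≢ {u = x ∷ u} {y ∷ w} u≢w with x ≟ y
... | no _     = zero , refl
... | yes refl = Product.map suc id (agreement-≢ (λ u≡w → u≢w (cong (x ∷_) u≡w)))

-- The first s·m points form s blocks of m points; letter j of u selects a point of block j.
encode : ∀ {m s} r → Vec (Fin m) s → Subset (s * m + r)
encode r u = concat (map ⁅_⁆ u) ++ ⊥

∣encode∣ : ∀ {m s} r (u : Vec (Fin m) s) → ∣ encode r u ∣ ≡ s
∣encode∣ r u = begin
  ∣ concat (map ⁅_⁆ u) ++ ⊥ ∣      ≡⟨ ∣p++q∣ (concat (map ⁅_⁆ u)) (⊥ {r}) ⟩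
  ∣ concat (map ⁅_⁆ u) ∣ + ∣ ⊥ {r} ∣  ≡⟨ cong₂ _+_ (blocks u) (∣⊥∣≡0 r) ⟩
  _ + 0                             ≡⟨ +-identityʳ _ ⟩
  _                                 ∎
  where
  open ≡-Reasoning
  blocks : ∀ {s} (u : Vec (Fin _) s) → ∣ concat (map ⁅_⁆ u) ∣ ≡ s
  blocks []      = refl
  blocks (x ∷ u) = trans (∣p++q∣ ⁅ x ⁆ _) (cong₂ _+_ (∣⁅x⁆∣≡1 x) (blocks u))

disjointᵇ-encode : ∀ {m s} r (u w : Vec (Fin m) s) →
  disjointᵇ (encode r u) (encode r w) ≡ disjointᵇ ⊤ (agreement u w)
disjointᵇ-encode r u w = begin
  disjointᵇ (encode r u) (encode r w)
    ≡⟨ disjointᵇ-++ (concat (map ⁅_⁆ u)) (concat (map ⁅_⁆ w)) (⊥ {r}) ⊥ ⟩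
  disjointᵇ (concat (map ⁅_⁆ u)) (concat (map ⁅_⁆ w)) ∧ disjointᵇ (⊥ {r}) ⊥
    ≡⟨ cong₂ _∧_ (blocks u w) (disjointᵇ-⊥ˡ ⊥) ⟩
  disjointᵇ ⊤ (agreement u w) ∧ true
    ≡⟨ ∧-identityʳ _ ⟩
  disjointᵇ ⊤ (agreement u w) ∎
  where
  open ≡-Reasoning
  blocks : ∀ {s} (u w : Vec (Fin _) s) →
    disjointᵇ (concat (map ⁅_⁆ u)) (concat (map ⁅_⁆ w)) ≡ disjointᵇ ⊤ (agreement u w)
  blocks []      []      = refl
  blocks (x ∷ u) (y ∷ w) = begin
    disjointᵇ (⁅ x ⁆ ++ concat (map ⁅_⁆ u)) (⁅ y ⁆ ++ concat (map ⁅_⁆ w))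
      ≡⟨ disjointᵇ-++ ⁅ x ⁆ ⁅ y ⁆ _ _ ⟩
    disjointᵇ ⁅ x ⁆ ⁅ y ⁆ ∧ disjointᵇ (concat (map ⁅_⁆ u)) (concat (map ⁅_⁆ w))
      ≡⟨ cong₂ _∧_ (disjointᵇ-⁅⁆ x y) (blocks u w) ⟩
    not (does (x ≟ y)) ∧ disjointᵇ ⊤ (agreement u w)
      ≡⟨ disjointᵇ-∷ true (does (x ≟ y)) ⊤ (agreement u w) ⟨
    disjointᵇ ⊤ (agreement (x ∷ u) (y ∷ w)) ∎

select : ∀ {A : Set} {t} → Subset t → A → Vec A t → Vec A t
select V p a = zipWith (λ v x → if v then x else p) V a

-- Padded with the letter at a pivot i₀ ∈ V, the columns of a and b meet iff a and b agree
-- somewhere on V.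
column : ∀ {m t} d → Subset t → Fin t → Vec (Fin m) t → Vec (Fin m) (t + d)
column d V i₀ a = select V (lookup a i₀) a ++ replicate d (lookup a i₀)

agreement-column : ∀ {m t} d (V : Subset t) i₀ (a b : Vec (Fin m) t) →
  let e = lookup (agreement a b) i₀ in
  agreement (column d V i₀ a) (column d V i₀ b) ≡ select V e (agreement a b) ++ replicate d e
agreement-column d V i₀ a b = begin
  agreement (column d V i₀ a) (column d V i₀ b)
    ≡⟨ zipWith-++ _ (select V p a) (replicate d p) (select V q b) (replicate d q) ⟩
  agreement (select V p a) (select V q b) ++ agreement (replicate d p) (replicate d q)
    ≡⟨ cong₂ _++_ (agreement-select V a b) (zipWith-replicate _ p q) ⟩
  select V (does (p ≟ q)) (agreement a b) ++ replicate d (does (p ≟ q))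
    ≡⟨ cong (λ e → select V e (agreement a b) ++ replicate d e) (lookup-zipWith _ i₀ a b) ⟨
  select V e (agreement a b) ++ replicate d e ∎
  where
  open ≡-Reasoning
  p q : Fin _
  p = lookup a i₀
  q = lookup b i₀
  e : Bool
  e = lookup (agreement a b) i₀
  agreement-select : ∀ {t} (V : Subset t) a b →
    agreement (select V p a) (select V q b) ≡ select V (does (p ≟ q)) (agreement a b)
  agreement-select []          []      []      = refl
  agreement-select (true ∷ V)  (x ∷ a) (y ∷ b) = cong (does (x ≟ y) ∷_) (agreement-select V a b)
  agreement-select (false ∷ V) (x ∷ a) (y ∷ b) = cong (does (p ≟ q) ∷_) (agreement-select V a b)

select-pivot : ∀ {A : Set} {t} (V : Subset t) {i₀} (p : A) a → T (lookup V i₀) →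
  lookup (select V p a) i₀ ≡ lookup a i₀
select-pivot (true ∷ V) {zero}   p (x ∷ a) _   = refl
select-pivot (v ∷ V)    {suc i₀} p (x ∷ a) Vi₀ = select-pivot V p a Vi₀

disjointᵇ-padded : ∀ {t} d (V E : Subset t) {i₀} → T (lookup V i₀) →
  disjointᵇ ⊤ (select V (lookup E i₀) E ++ replicate d (lookup E i₀)) ≡ disjointᵇ V E
disjointᵇ-padded {t} d V E {i₀} Vi₀ with lookup E i₀ in Eᵢ₀
... | false = begin
  disjointᵇ ⊤ (select V false E ++ ⊥)                 ≡⟨ cong (λ X → disjointᵇ X (select V false E ++ ⊥)) (⊤-++ t d) ⟩
  disjointᵇ (⊤ {t} ++ ⊤ {d}) (select V false E ++ ⊥)  ≡⟨ disjointᵇ-++ (⊤ {t}) (select V false E) ⊤ ⊥ ⟩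
  disjointᵇ ⊤ (select V false E) ∧ disjointᵇ ⊤ ⊥      ≡⟨ cong₂ _∧_ (unpadded V E) (disjointᵇ-⊥ʳ ⊤) ⟩
  disjointᵇ V E ∧ true                                ≡⟨ ∧-identityʳ _ ⟩
  disjointᵇ V E                                       ∎
  where
  open ≡-Reasoning
  unpadded : ∀ {t} (V E : Subset t) → disjointᵇ ⊤ (select V false E) ≡ disjointᵇ V E
  unpadded []          []      = refl
  unpadded (true ∷ V)  (x ∷ E) =
    trans (disjointᵇ-∷ true x ⊤ _) (trans (cong (not x ∧_) (unpadded V E)) (sym (disjointᵇ-∷ true x V E)))
  unpadded (false ∷ V) (x ∷ E) =
    trans (disjointᵇ-∷ true false ⊤ _) (trans (unpadded V E) (sym (disjointᵇ-∷ false x V E)))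
... | true = begin
  disjointᵇ ⊤ (select V true E ++ replicate d true)
    ≡⟨ cong (λ X → disjointᵇ X (select V true E ++ replicate d true)) (⊤-++ t d) ⟩
  disjointᵇ (⊤ {t} ++ ⊤ {d}) (select V true E ++ replicate d true)
    ≡⟨ disjointᵇ-++ (⊤ {t}) (select V true E) ⊤ (replicate d true) ⟩
  disjointᵇ ⊤ (select V true E) ∧ disjointᵇ ⊤ (replicate d true)
    ≡⟨ cong (_∧ _) (common⇒¬disjointᵇ {A = ⊤} {B = select V true E} i₀ ⊤ᵢ₀ selectedᵢ₀) ⟩
  false
    ≡⟨ common⇒¬disjointᵇ {A = V} {B = E} i₀ Vi₀ (Equivalence.from T-≡ Eᵢ₀) ⟨
  disjointᵇ V E ∎
  where
  open ≡-Reasoning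
  ⊤ᵢ₀ : T (lookup (⊤ {t}) i₀)
  ⊤ᵢ₀ = Equivalence.from T-≡ (lookup-replicate i₀ true)
  selectedᵢ₀ : T (lookup (select V true E) i₀)
  selectedᵢ₀ = Equivalence.from T-≡ (trans (select-pivot V true E Vi₀) Eᵢ₀)

disjointᵇ-encode-column : ∀ {m t} r d (V : Subset t) {i₀} (a b : Vec (Fin m) t) → T (lookup V i₀) →
  disjointᵇ (encode r (column d V i₀ a)) (encode r (column d V i₀ b)) ≡ disjointᵇ V (agreement a b)
disjointᵇ-encode-column r d V {i₀} a b Vi₀ = begin
  disjointᵇ (encode r (column d V i₀ a)) (encode r (column d V i₀ b))
    ≡⟨ disjointᵇ-encode r _ _ ⟩
  disjointᵇ ⊤ (agreement (column d V i₀ a) (column d V i₀ b))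
    ≡⟨ cong (disjointᵇ ⊤) (agreement-column d V i₀ a b) ⟩
  disjointᵇ ⊤ (select V e (agreement a b) ++ replicate d e)
    ≡⟨ disjointᵇ-padded d V (agreement a b) Vi₀ ⟩
  disjointᵇ V (agreement a b) ∎
  where
  open ≡-Reasoning
  e : Bool
  e = lookup (agreement a b) i₀

PointedSubset : ℕ → Set
PointedSubset t = Σ (Subset t) λ V → ∃ λ i → T (lookup V i)

extend : ∀ {t} → Bool → PointedSubset t → PointedSubset (suc t)
extend v (V , i , Vi) = v ∷ V , suc i , Vi

nonemptySubsets : ∀ t → List (PointedSubset t)
nonemptySubsets zero    = []
nonemptySubsets (suc t) =
  List.map (extend false) (nonemptySubsets t)
    List.++ (⁅ zero ⁆ , zero , _) ∷ List.map (extend true) (nonemptySubsets t)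

1+length-nonemptySubsets : ∀ t → 1 + length (nonemptySubsets t) ≡ 2 ^ t
1+length-nonemptySubsets zero    = refl
1+length-nonemptySubsets (suc t) = begin
  1 + length (List.map (extend false) L List.++ _ ∷ List.map (extend true) L)
    ≡⟨ cong suc (length-++ (List.map (extend false) L)) ⟩
  1 + (length (List.map (extend false) L) + (1 + length (List.map (extend true) L)))
    ≡⟨ cong₂ (λ a b → 1 + (a + (1 + b))) (length-map (extend false) L) (length-map (extend true) L) ⟩
  (1 + length L) + (1 + length L)
    ≡⟨ cong₂ _+_ (1+length-nonemptySubsets t) (trans (1+length-nonemptySubsets t) (sym (+-identityʳ _))) ⟩
  2 ^ suc t ∎
  where
  open ≡-Reasoning
  L : List (PointedSubset t)
  L = nonemptySubsets t

-- The number of nonempty V ⊆ [t] disjoint from A, that is 2^(t - ∣A∣) - 1.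
avoiding : ∀ {t} → Subset t → ℕ
avoiding {t} A = sum (List.map (λ V → ⟦ disjointᵇ (proj₁ V) A ⟧) (nonemptySubsets t))

avoiding-∷ : ∀ {t} α (A : Subset t) → avoiding (α ∷ A) ≡ avoiding A + (if α then 0 else suc (avoiding A))
avoiding-∷ {t} α A = begin
  sum (List.map g (List.map (extend false) L List.++ V₀ ∷ List.map (extend true) L))
    ≡⟨ cong sum (map-++ g (List.map (extend false) L) _) ⟩
  sum (List.map g (List.map (extend false) L) List.++ List.map g (V₀ ∷ List.map (extend true) L))
    ≡⟨ sum-++ (List.map g (List.map (extend false) L)) _ ⟩
  sum (List.map g (List.map (extend false) L)) + (g V₀ + sum (List.map g (List.map (extend true) L)))
    ≡⟨ cong₂ (λ x y → x + (g V₀ + y)) (cong sum (map-∘ L)) (cong sum (map-∘ L)) ⟨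
  sum (List.map (g ∘ extend false) L) + (g V₀ + sum (List.map (g ∘ extend true) L))
    ≡⟨ cong₂ (λ x y → x + (y + sum (List.map (g ∘ extend true) L))) (cong sum (map-cong outside L)) singleton ⟩
  avoiding A + (⟦ not α ⟧ + sum (List.map (g ∘ extend true) L))
    ≡⟨ cong (λ x → avoiding A + (⟦ not α ⟧ + sum x)) (map-cong inside L) ⟩
  avoiding A + (⟦ not α ⟧ + sum (List.map (λ V → ⟦ not α ∧ disjointᵇ (proj₁ V) A ⟧) L))
    ≡⟨ cong (avoiding A +_) (by-cases α) ⟩
  avoiding A + (if α then 0 else suc (avoiding A)) ∎
  where
  open ≡-Reasoning
  L : List (PointedSubset t)
  L = nonemptySubsets t
  g : PointedSubset (suc t) → ℕ
  g V = ⟦ disjointᵇ (proj₁ V) (α ∷ A) ⟧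
  V₀ : PointedSubset (suc t)
  V₀ = ⁅ zero ⁆ , zero , _
  outside : ∀ V → g (extend false V) ≡ ⟦ disjointᵇ (proj₁ V) A ⟧
  outside V = cong ⟦_⟧ (disjointᵇ-∷ false α (proj₁ V) A)
  singleton : g V₀ ≡ ⟦ not α ⟧
  singleton = cong ⟦_⟧ (trans (disjointᵇ-∷ true α ⊥ A) (trans (cong (not α ∧_) (disjointᵇ-⊥ˡ A)) (∧-identityʳ _)))
  inside : ∀ V → g (extend true V) ≡ ⟦ not α ∧ disjointᵇ (proj₁ V) A ⟧
  inside V = cong ⟦_⟧ (disjointᵇ-∷ true α (proj₁ V) A)
  by-cases : ∀ β → ⟦ not β ⟧ + sum (List.map (λ V → ⟦ not β ∧ disjointᵇ (proj₁ V) A ⟧) L)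
                 ≡ (if β then 0 else suc (avoiding A))
  by-cases false = refl
  by-cases true  = sum-zeros L
    where
    sum-zeros : ∀ {X : Set} (xs : List X) → sum (List.map (λ _ → 0) xs) ≡ 0
    sum-zeros []       = refl
    sum-zeros (_ ∷ xs) = sum-zeros xs

avoiding-odd : ∀ {t} (A : Subset t) j → lookup A j ≡ false → avoiding A % 2 ≡ 1
avoiding-odd (false ∷ A) _       _  = begin
  avoiding (false ∷ A) % 2           ≡⟨ cong (_% 2) (avoiding-∷ false A) ⟩
  (avoiding A + suc (avoiding A)) % 2 ≡⟨ cong (_% 2) (S+1+S≡1+S*2 (avoiding A)) ⟩
  (1 + avoiding A * 2) % 2           ≡⟨ [m+kn]%n≡m%n 1 (avoiding A) 2 ⟩
  1                                   ∎
  where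
  open ≡-Reasoning
  S+1+S≡1+S*2 : ∀ S → S + suc S ≡ 1 + S * 2
  S+1+S≡1+S*2 = solve-∀
avoiding-odd (true ∷ A)  (suc j) Aj =
  trans (cong (_% 2) (trans (avoiding-∷ true A) (+-identityʳ _))) (avoiding-odd A j Aj)

word : ∀ {m t} → Fin (m ^ t) → Vec (Fin m) t
word = tabulate ∘ finToFun

word-injective : ∀ {m t} {i j : Fin (m ^ t)} → word {m} {t} i ≡ word j → i ≡ j
word-injective {m} {t} {i} {j} eq = begin
  i                             ≡⟨ funToFin-finToFin {t} {m} i ⟨
  funToFin (finToFun {m} {t} i) ≡⟨ funToFin-cong (λ x → trans (sym (lookup∘tabulate (finToFun i) x))
                                                    (trans (cong (λ v → lookup v x) eq) (lookup∘tabulate (finToFun j) x))) ⟩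
  funToFin (finToFun {m} {t} j) ≡⟨ funToFin-finToFin {t} {m} j ⟩
  j                             ∎
  where
  open ≡-Reasoning
  funToFin-cong : ∀ {s} {f g : Fin s → Fin m} → (∀ x → f x ≡ g x) → funToFin f ≡ funToFin g
  funToFin-cong {zero}  f≗g = refl
  funToFin-cong {suc s} f≗g = cong₂ combine (f≗g zero) (funToFin-cong (f≗g ∘ suc))

module Construction {m : ℕ} (t d e r : ℕ) (a₀ : Fin m) .{{_ : NonZero (t + d)}} where

  pad : Subset ((t + d) * m + r)
  pad = encode r (replicate (t + d) a₀)

  coordinate : Vec (Fin m) t → PointedSubset t → Subset ((t + d) * m + r)
  coordinate a (V , i₀ , _) = encode r (column d V i₀ a)

  vertex : Vec (Fin m) t → Vec (Subset ((t + d) * m + r)) (length (nonemptySubsets t) + e)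
  vertex a = map (coordinate a) (fromList (nonemptySubsets t)) ++ replicate e pad

  pads-isVertex : IsXorVertex e ((t + d) * m + r) (t + d) (replicate e pad)
  pads-isVertex =
    VAll.lookup⁻ (λ i → trans (cong ∣_∣ (lookup-replicate i pad)) (∣encode∣ r (replicate (t + d) a₀)))

  vertex-isVertex : ∀ a → IsXorVertex _ ((t + d) * m + r) (t + d) (vertex a)
  vertex-isVertex a =
    VAll.++⁺ (VAll.map⁺ (VAll.universal (λ (V , i₀ , _) → ∣encode∣ r (column d V i₀ a)) _)) pads-isVertex

  numAdjCoords-vertex : ∀ a b → numAdjCoords (vertex a) (vertex b) ≡ avoiding (agreement a b)
  numAdjCoords-vertex a b = begin
    numAdjCoords (vertex a) (vertex b)
      ≡⟨ numAdjCoords-++ (map (coordinate a) coords) (map (coordinate b) coords) pads pads ⟩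
    numAdjCoords (map (coordinate a) coords) (map (coordinate b) coords) + numAdjCoords pads pads
      ≡⟨ cong₂ _+_ (numAdjCoords-map (coordinate a) (coordinate b) (nonemptySubsets t))
                   (numAdjCoords-self pads pads-isVertex) ⟩
    sum (List.map (λ V → ⟦ disjointᵇ (coordinate a V) (coordinate b V) ⟧) (nonemptySubsets t)) + 0
      ≡⟨ +-identityʳ _ ⟩
    sum (List.map (λ V → ⟦ disjointᵇ (coordinate a V) (coordinate b V) ⟧) (nonemptySubsets t))
      ≡⟨ cong sum (map-cong (λ (V , _ , Vi₀) → cong ⟦_⟧ (disjointᵇ-encode-column r d V a b Vi₀))
                            (nonemptySubsets t)) ⟩
    avoiding (agreement a b) ∎
    where
    open ≡-Reasoning
    coords : Vec (PointedSubset t) (length (nonemptySubsets t))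
    coords = fromList (nonemptySubsets t)
    pads : Vec (Subset ((t + d) * m + r)) e
    pads = replicate e pad

  vertex-adjacent : ∀ {a b} → a ≢ b → XorAdj (vertex a) (vertex b)
  vertex-adjacent {a} {b} a≢b = odd⇒distinct (vertex-isVertex a) odd , odd
    where
    odd : numAdjCoords (vertex a) (vertex b) % 2 ≡ 1
    odd = let j , a≢ⱼb = agreement-≢ a≢b
          in trans (cong (_% 2) (numAdjCoords-vertex a b)) (avoiding-odd (agreement a b) j a≢ⱼb)

  clique : fLowerBound (length (nonemptySubsets t) + e) ((t + d) * m + r) (t + d) (m ^ t)
  clique = List.tabulate (vertex ∘ word)
         , ( All.tabulate⁺ (λ _ → vertex-isVertex _)
           , AllPairs.tabulate⁺ (λ i≢j → vertex-adjacent (i≢j ∘ word-injective)) )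
         , ≤-reflexive (sym (length-tabulate (vertex ∘ word)))

2^⌊log₂n⌋≤n : ∀ n .{{_ : NonZero n}} → 2 ^ ⌊log₂ n ⌋ ≤ n
2^⌊log₂n⌋≤n n = go n (<-wellFounded n)
  where
  go : ∀ n (acc : Acc _<_ n) .{{_ : NonZero n}} → 2 ^ ⌊log2⌋ n acc ≤ n
  go 1             _        = ≤-refl
  go (suc (suc n)) (acc rs) = begin
    2 * 2 ^ ⌊log2⌋ (suc h) _  ≤⟨ *-monoʳ-≤ 2 (go (suc h) _) ⟩
    2 * suc h                 ≡⟨ *-suc 2 h ⟩
    2 + (h + (h + 0))         ≤⟨ +-monoʳ-≤ (2 + h) (≤-trans (≤-reflexive (+-identityʳ h)) (⌊n/2⌋≤⌈n/2⌉ n)) ⟩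
    2 + (h + ⌈ n /2⌉)         ≡⟨ cong (2 +_) (⌊n/2⌋+⌈n/2⌉≡n n) ⟩
    2 + n                     ∎
    where
    open ≤-Reasoning
    h : ℕ
    h = ⌊ n /2⌋

fLowerBound-construction : ∀ {ℓ n k m t} .{{_ : NonZero k}} .{{_ : NonZero m}} →
  t ≤ k → 2 ^ t ≤ suc ℓ → k * m ≤ n → fLowerBound ℓ n k (m ^ t)
fLowerBound-construction {ℓ} {n} {k} {suc m} {t} t≤k 2^t≤1+ℓ km≤n
  -- write k = t + d, ℓ = (2^t - 1) + e and n = k·m + r
  with k ∸ t | m+[n∸m]≡n t≤k
     | ℓ ∸ length (nonemptySubsets t) | m+[n∸m]≡n L≤ℓ
     | n ∸ k * suc m | m+[n∸m]≡n km≤n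
  where
  L≤ℓ : length (nonemptySubsets t) ≤ ℓ
  L≤ℓ = s≤s⁻¹ (subst (_≤ suc ℓ) (sym (1+length-nonemptySubsets t)) 2^t≤1+ℓ)
... | d | refl | e | refl | r | refl = Construction.clique t d e r zero

fLowerBound-⌊log₂⌋ : ∀ ℓ n k .{{_ : NonZero ℓ}} .{{_ : NonZero k}} →
  ⌊log₂ (ℓ + 1) ⌋ ≤ k → fLowerBound ℓ n k ((n / k) ^ ⌊log₂ (ℓ + 1) ⌋)
fLowerBound-⌊log₂⌋ ℓ n k t≤k with ℓ + 1 | +-comm ℓ 1
... | _ | refl with n / k | subst (_≤ n) (*-comm (n / k) k) (m/n*n≤m n k)
...   | zero  | _    = [] , ([] , []) , ≤-reflexive (0^t≡0 (⌊log₂⌋-mono-≤ (s≤s (>-nonZero⁻¹ ℓ))))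
  where
  0^t≡0 : ∀ {t} → 1 ≤ t → 0 ^ t ≡ 0
  0^t≡0 (s≤s _) = refl
...   | suc _ | km≤n = fLowerBound-construction t≤k (2^⌊log₂n⌋≤n (suc ℓ)) km≤n

theorem1p3 : (ℓ n k : ℕ) → .{{_ : NonZero ℓ}} → .{{_ : NonZero n}} → .{{_ : NonZero k}} →
    fUpperBound ℓ n k (2 ^ (ℓ / 2) * (ℓ / 2) ! * n ^ ((ℓ + 1) / 2))
    × (⌊log₂ (ℓ + 1) ⌋ ≤ k → fLowerBound ℓ n k ((n / k) ^ ⌊log₂ (ℓ + 1) ⌋))
theorem1p3 ℓ n k = UpperBound.fUpperBound-formula n k ℓ , fLowerBound-⌊log₂⌋ ℓ n k
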